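{- Let $p$ be a prime and $k\geq 1$ an integer. Then $a(p^k)=k(p-1)+1$.
   Context: For a positive integer $n$, consider the random walk on $\mathbb{Z}/n\mathbb{Z}$ that starts at the residue $1 \pmod n$ and at each step multiplies the current state by a residue chosen uniformly at random from $\mathbb{Z}/n\mathbb{Z}$, independently of previous choices. The state $0\pmod n$ is absorbing. $a(n)$ denotes the expected number of steps until the walk first reaches $0 \pmod n$ (so $a(1)=0$). -}

module Defs where

open import Data.Bool using (Bool; true; false; not; _∧_; if_then_else_)
open import Data.Nat as ℕ using (ℕ; zero; suc; _≡ᵇ_; _^_; NonZero)
open import Data.Nat.Properties using (m^n≢0)
open import Data.Nat.DivMod using (_%_)
open import Data.Nat.Primality using (Prime; prime⇒nonZero)
open import Data.List using (List; []; _∷_; [_]; map; concatMap; upTo; length; filterᵇ)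
open import Data.Integer using (+_)
open import Data.Rational using (ℚ; _/_; _+_; _*_; _-_; ∣_∣; _<_; 0ℚ)
open import Data.Product using (∃-syntax)

-- All step sequences (r₁,…,r_t) of length t with entries in ℤ/nℤ = {0,…,n-1}.
allSeqs : ℕ → ℕ → List (List ℕ)
allSeqs n zero = [ [] ]
allSeqs n (suc t) = concatMap (λ r → map (r ∷_) (allSeqs n t)) (upTo n)

run : (n : ℕ) → .{{NonZero n}} → ℕ → List ℕ → List ℕ
run n x [] = [ x ]
run n x (r ∷ rs) = x ∷ run n ((x ℕ.* r) % n) rs

firstHitAtEnd : List ℕ → Bool
firstHitAtEnd [] = false
firstHitAtEnd (x ∷ []) = x ≡ᵇ 0
firstHitAtEnd (x ∷ y ∷ ys) = not (x ≡ᵇ 0) ∧ firstHitAtEnd (y ∷ ys)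

trajectory : (n : ℕ) → .{{NonZero n}} → List ℕ → List ℕ
trajectory n rs = run n (1 % n) rs

-- P(T = t), with T the absorption time, under uniform independent steps:
-- (number of step sequences of length t hitting 0 first at time t) / n^t.
probHit : (n : ℕ) → .{{NonZero n}} → ℕ → ℚ
probHit n t =
  _/_ (+ length (filterᵇ (λ rs → firstHitAtEnd (trajectory n rs)) (allSeqs n t)))
      (n ^ t) {{m^n≢0 n t}}

partialExp : (n : ℕ) → .{{NonZero n}} → ℕ → ℚ
partialExp n zero = 0ℚ
partialExp n (suc N) = partialExp n N + ((+ N) / 1) * probHit n N

ExpectedHittingTime : (n : ℕ) → .{{NonZero n}} → ℚ → Set
ExpectedHittingTime n v =
  ∀ (ε : ℚ) → 0ℚ < ε → ∃[ N₀ ] ∀ N → N₀ ℕ.≤ N → ∣ partialExp n N - v ∣ < ε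

primePow≢0 : ∀ {p} (k : ℕ) → Prime p → NonZero (p ^ k)
primePow≢0 {p} k pr = m^n≢0 p k {{prime⇒nonZero pr}}

-- Write n = p ^ k and q = p ∸ 1. The function h with h(0) = 0 and
-- h(y) = 1 + q (k - v_p(y)) on nonzero residues is harmonic off 0:
-- n h(y) = n + Σ_r h(y r mod n), because multiplying by a uniform r raises the
-- p-adic valuation by at least e with probability p^(-e). Iterating this identity
-- along all step sequences of length N gives, for the absorption time T,
-- Σ_{t<N} t P(T = t) + E[T ; T ≥ N] = h(1) = k q + 1.  A path survives a step only
-- if r ≠ 0, so E[T ; T ≥ N] = O(N ((n-1)/n)^N), which tends to 0 by a
-- Bernoulli-type inequality.

module Submission where

open import Data.Bool using (Bool; true; false; not; _∧_; if_then_else_)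
open import Data.Nat as ℕ
  using (ℕ; zero; suc; pred; _+_; _*_; _∸_; _^_; _≤_; _<_; _≡ᵇ_; _≤?_; NonZero; z≤n; s≤s)
open import Data.Nat.Properties
open import Algebra.Properties.CommutativeSemigroup +-commutativeSemigroup using (interchange)
open import Algebra.Properties.CommutativeSemigroup *-commutativeSemigroup using (x∙yz≈y∙xz)
open import Data.Nat.Divisibility
open import Data.Nat.Primality using (Prime; prime⇒nonZero; prime⇒nonTrivial; euclidsLemma)
open import Data.Nat.Induction using (<-rec)
open import Data.Sum using (inj₁; inj₂)
open import Relation.Nullary using (Dec; yes; no; does; ¬_; ¬?; contradiction)
open import Data.Nat.DivMod using (_%_; m%n<n; m*n%n≡0; m<n⇒m%n≡m)
open import Data.List using (List; []; _∷_; _++_; map; concatMap; upTo; applyUpTo; length; filterᵇ)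
open import Data.Nat.ListAction using (sum)
open import Function using (_∘_)
open import Relation.Binary.PropositionalEquality
open import Data.Nat.Tactic.RingSolver using (solve-∀)
open import Data.Product using (_×_; _,_; proj₁; proj₂; ∃-syntax)

open import Defs

-- Finite sums and counting

∑< : ℕ → (ℕ → ℕ) → ℕ
∑< zero    f = 0
∑< (suc m) f = f 0 + ∑< m (f ∘ suc)

syntax ∑< m (λ r → e) = ∑[ r < m ] e

∑-cong : ∀ m {f g : ℕ → ℕ} → (∀ r → r < m → f r ≡ g r) → ∑< m f ≡ ∑< m g
∑-cong zero    eq = refl
∑-cong (suc m) eq = cong₂ _+_ (eq 0 (s≤s z≤n)) (∑-cong m (λ r r<m → eq (suc r) (s≤s r<m)))

∑-distrib-+ : ∀ m (f g : ℕ → ℕ) → ∑[ r < m ] (f r + g r) ≡ ∑< m f + ∑< m g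
∑-distrib-+ zero    f g = refl
∑-distrib-+ (suc m) f g =
  trans (cong (f 0 + g 0 +_) (∑-distrib-+ m (f ∘ suc) (g ∘ suc))) (interchange (f 0) (g 0) _ _)

*-distribˡ-∑ : ∀ m c (f : ℕ → ℕ) → c * ∑< m f ≡ ∑[ r < m ] (c * f r)
*-distribˡ-∑ zero    c f = *-zeroʳ c
*-distribˡ-∑ (suc m) c f = trans (*-distribˡ-+ c (f 0) _) (cong (c * f 0 +_) (*-distribˡ-∑ m c (f ∘ suc)))

∑-const : ∀ m c → ∑[ r < m ] c ≡ m * c
∑-const zero    c = refl
∑-const (suc m) c = cong (c +_) (∑-const m c)

∑-mono-≤ : ∀ m {f g : ℕ → ℕ} → (∀ r → f r ≤ g r) → ∑< m f ≤ ∑< m g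
∑-mono-≤ zero    f≤g = z≤n
∑-mono-≤ (suc m) f≤g = +-mono-≤ (f≤g 0) (∑-mono-≤ m (f≤g ∘ suc))

∑-≤-[m∸1]* : ∀ m B (f : ℕ → ℕ) → f 0 ≡ 0 → (∀ r → f r ≤ B) → ∑< m f ≤ (m ∸ 1) * B
∑-≤-[m∸1]* zero    B f f0≡0 f≤B = z≤n
∑-≤-[m∸1]* (suc m) B f f0≡0 f≤B = begin
  f 0 + ∑< m (f ∘ suc)  ≡⟨ cong (_+ ∑< m (f ∘ suc)) f0≡0 ⟩
  ∑< m (f ∘ suc)        ≤⟨ ∑-mono-≤ m (f≤B ∘ suc) ⟩
  ∑[ r < m ] B          ≡⟨ ∑-const m B ⟩
  m * B                 ∎
  where open ≤-Reasoning

∑-split : ∀ a b (f : ℕ → ℕ) → ∑< (a + b) f ≡ ∑< a f + ∑[ r < b ] f (a + r)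
∑-split zero    b f = refl
∑-split (suc a) b f = trans (cong (f 0 +_) (∑-split a b (f ∘ suc))) (sym (+-assoc (f 0) _ _))

∑-comm : ∀ m k (F : ℕ → ℕ → ℕ) → ∑[ r < m ] ∑[ i < k ] F i r ≡ ∑[ i < k ] ∑[ r < m ] F i r
∑-comm zero    k F = sym (trans (∑-const k 0) (*-zeroʳ k))
∑-comm (suc m) k F = begin
  ∑[ i < k ] F i 0 + ∑[ r < m ] ∑[ i < k ] F i (suc r)  ≡⟨ cong (∑[ i < k ] F i 0 +_) (∑-comm m k (λ i → F i ∘ suc)) ⟩
  ∑[ i < k ] F i 0 + ∑[ i < k ] ∑[ r < m ] F i (suc r)  ≡⟨ ∑-distrib-+ k _ _ ⟨
  ∑[ i < k ] ∑[ r < suc m ] F i r                         ∎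
  where open ≡-Reasoning

∑-telescope : ∀ m (f : ℕ → ℕ) → ∑< m f + f m ≡ f 0 + ∑< m (f ∘ suc)
∑-telescope zero    f = +-comm 0 (f 0)
∑-telescope (suc m) f = trans (+-assoc (f 0) _ _) (cong (f 0 +_) (∑-telescope m (f ∘ suc)))

sum-map-applyUpTo : ∀ m (f g : ℕ → ℕ) → sum (map f (applyUpTo g m)) ≡ ∑[ r < m ] f (g r)
sum-map-applyUpTo zero    f g = refl
sum-map-applyUpTo (suc m) f g = cong (f (g 0) +_) (sum-map-applyUpTo m f (g ∘ suc))

sum-map-upTo : ∀ m (f : ℕ → ℕ) → sum (map f (upTo m)) ≡ ∑< m f
sum-map-upTo m f = sum-map-applyUpTo m f (λ r → r)

module _ {A : Set} where

  length-filterᵇ-++ : ∀ (P : A → Bool) xs ys →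
    length (filterᵇ P (xs ++ ys)) ≡ length (filterᵇ P xs) + length (filterᵇ P ys)
  length-filterᵇ-++ P []       ys = refl
  length-filterᵇ-++ P (x ∷ xs) ys with P x
  ... | true  = cong suc (length-filterᵇ-++ P xs ys)
  ... | false = length-filterᵇ-++ P xs ys

  length-filterᵇ-cong : ∀ {P Q : A → Bool} → (∀ x → P x ≡ Q x) → ∀ xs →
    length (filterᵇ P xs) ≡ length (filterᵇ Q xs)
  length-filterᵇ-cong {P} {Q} P≗Q []       = refl
  length-filterᵇ-cong {P} {Q} P≗Q (x ∷ xs) with P x | Q x | P≗Q x
  ... | true  | .true  | refl = cong suc (length-filterᵇ-cong P≗Q xs)
  ... | false | .false | refl = length-filterᵇ-cong P≗Q xs

  length-filterᵇ-false : ∀ xs → length (filterᵇ (λ (_ : A) → false) xs) ≡ 0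
  length-filterᵇ-false []       = refl
  length-filterᵇ-false (x ∷ xs) = length-filterᵇ-false xs

module _ {A B : Set} (P : B → Bool) where

  length-filterᵇ-map : ∀ (g : A → B) xs → length (filterᵇ P (map g xs)) ≡ length (filterᵇ (P ∘ g) xs)
  length-filterᵇ-map g []       = refl
  length-filterᵇ-map g (x ∷ xs) with P (g x)
  ... | true  = cong suc (length-filterᵇ-map g xs)
  ... | false = length-filterᵇ-map g xs

  length-filterᵇ-concatMap : ∀ (F : A → List B) xs →
    length (filterᵇ P (concatMap F xs)) ≡ sum (map (λ x → length (filterᵇ P (F x))) xs)
  length-filterᵇ-concatMap F []       = refl
  length-filterᵇ-concatMap F (x ∷ xs) =
    trans (length-filterᵇ-++ P (F x) (concatMap F xs)) (cong (_ +_) (length-filterᵇ-concatMap F xs))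

-- Indicators and divisibility

𝟙 : {P : Set} → Dec P → ℕ
𝟙 P? = if does P? then 1 else 0

module _ {P : Set} where

  𝟙-yes : (P? : Dec P) → P → 𝟙 P? ≡ 1
  𝟙-yes P? p with P?
  ... | yes _  = refl
  ... | no ¬p = contradiction p ¬p

  𝟙-no : (P? : Dec P) → ¬ P → 𝟙 P? ≡ 0
  𝟙-no P? ¬p with P?
  ... | yes p = contradiction p ¬p
  ... | no _  = refl

  𝟙+𝟙¬ : (P? : Dec P) → 𝟙 P? + 𝟙 (¬? P?) ≡ 1
  𝟙+𝟙¬ P? with P?
  ... | yes _ = refl
  ... | no _  = refl

  𝟙≤1 : (P? : Dec P) → 𝟙 P? ≤ 1
  𝟙≤1 P? with P?
  ... | yes _ = ≤-refl
  ... | no _  = z≤n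

  𝟙-⇔ : ∀ {Q : Set} (P? : Dec P) (Q? : Dec Q) → (P → Q) → (Q → P) → 𝟙 P? ≡ 𝟙 Q?
  𝟙-⇔ P? Q? P→Q Q→P with P? | Q?
  ... | yes _ | yes _ = refl
  ... | no _  | no _  = refl
  ... | yes p | no ¬q = contradiction (P→Q p) ¬q
  ... | no ¬p | yes q = contradiction (Q→P q) ¬p

∑-multiples : ∀ d m .{{_ : NonZero d}} → ∑[ r < d * m ] 𝟙 (d ∣? r) ≡ m
∑-multiples d zero    = cong (λ l → ∑[ r < l ] 𝟙 (d ∣? r)) (*-zeroʳ d)
∑-multiples d (suc m) = begin
  ∑[ r < d * suc m ] 𝟙 (d ∣? r)                           ≡⟨ cong (λ l → ∑[ r < l ] 𝟙 (d ∣? r)) (*-suc d m) ⟩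
  ∑[ r < d + d * m ] 𝟙 (d ∣? r)                           ≡⟨ ∑-split d (d * m) _ ⟩
  ∑[ r < d ] 𝟙 (d ∣? r) + ∑[ r < d * m ] 𝟙 (d ∣? d + r)   ≡⟨ cong₂ _+_ one-per-block shift ⟩
  1 + m                                                   ∎
  where
  open ≡-Reasoning
  one-per-block : ∑[ r < d ] 𝟙 (d ∣? r) ≡ 1
  one-per-block = begin
    ∑[ r < d ] 𝟙 (d ∣? r)                             ≡⟨ cong (λ l → ∑[ r < l ] 𝟙 (d ∣? r)) (suc-pred d) ⟨
    𝟙 (d ∣? 0) + ∑[ r < pred d ] 𝟙 (d ∣? suc r)       ≡⟨ cong₂ _+_ (𝟙-yes (d ∣? 0) (d ∣0)) (∑-cong (pred d) none) ⟩
    1 + ∑[ r < pred d ] 0                             ≡⟨ cong suc (trans (∑-const (pred d) 0) (*-zeroʳ (pred d))) ⟩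
    1                                                 ∎
    where
    none : ∀ r → r < pred d → 𝟙 (d ∣? suc r) ≡ 0
    none r r<d-1 = 𝟙-no (d ∣? suc r) (λ d∣1+r → <⇒≱ (subst (suc r <_) (suc-pred d) (s≤s r<d-1)) (∣⇒≤ d∣1+r))
  shift : ∑[ r < d * m ] 𝟙 (d ∣? d + r) ≡ m
  shift = trans (∑-cong (d * m) (λ r _ → 𝟙-⇔ (d ∣? d + r) (d ∣? r)
                    (λ d∣d+r → ∣m+n∣m⇒∣n d∣d+r ∣-refl) (∣m∣n⇒∣m+n ∣-refl)))
                (∑-multiples d m)

module _ {p : ℕ} (pr : Prime p) where
  private
    p≢0 : NonZero p
    p≢0 = prime⇒nonZero pr

  p-adic-decomposition : ∀ y → 0 < y → ∃[ j ] ∃[ u ] y ≡ p ^ j * u × ¬ p ∣ u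
  p-adic-decomposition = <-rec _ decompose
    where
    decompose : ∀ y → (∀ {z} → z < y → 0 < z → ∃[ j ] ∃[ u ] z ≡ p ^ j * u × ¬ p ∣ u) →
                0 < y → ∃[ j ] ∃[ u ] y ≡ p ^ j * u × ¬ p ∣ u
    decompose y rec 0<y with p ∣? y
    ... | no p∤y  = 0 , y , sym (*-identityˡ y) , p∤y
    ... | yes p∣y with rec (quotient-< p∣y) (ℕ.>-nonZero⁻¹ _ {{quotient≢0 p∣y}})
      where instance _ = prime⇒nonTrivial pr; _ = ℕ.>-nonZero 0<y
    ...   | j , u , z≡p^j*u , p∤u = suc j , u , y≡ , p∤u
      where
      y≡ : y ≡ p ^ suc j * u
      y≡ = trans (m∣n⇒n≡m*quotient p∣y) (trans (cong (p *_) z≡p^j*u) (sym (*-assoc p (p ^ j) u)))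

  ∣u*r⇒∣r : ∀ {u} → ¬ p ∣ u → ∀ e {r} → p ^ e ∣ u * r → p ^ e ∣ r
  ∣u*r⇒∣r         p∤u zero    _           = 1∣ _
  ∣u*r⇒∣r {u = u} p∤u (suc e) {r} p^[1+e]∣ur with euclidsLemma u r pr (∣-trans (m∣m*n (p ^ e)) p^[1+e]∣ur)
  ... | inj₁ p∣u                = contradiction p∣u p∤u
  ... | inj₂ (divides r′ refl) =
    subst (p ^ suc e ∣_) (*-comm p r′) (*-monoʳ-∣ p (∣u*r⇒∣r p∤u e (*-cancelˡ-∣ p {{p≢0}} p*p^e∣p*ur′)))
    where
    p*p^e∣p*ur′ : p * p ^ e ∣ p * (u * r′)
    p*p^e∣p*ur′ = subst (p * p ^ e ∣_) (trans (cong (u *_) (*-comm r′ p)) (x∙yz≈y∙xz u p r′)) p^[1+e]∣ur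

  p^[j+e]∣p^j*u*r⇒p^e∣r : ∀ j e {u r} → ¬ p ∣ u → p ^ (j + e) ∣ p ^ j * u * r → p ^ e ∣ r
  p^[j+e]∣p^j*u*r⇒p^e∣r j e {u} {r} p∤u p^[j+e]∣ = ∣u*r⇒∣r p∤u e
    (*-cancelˡ-∣ (p ^ j) {{m^n≢0 p j {{p≢0}}}} (subst₂ _∣_ (^-distribˡ-+-* p j e) (*-assoc (p ^ j) u r) p^[j+e]∣))

  p^e∣r⇒p^[j+e]∣p^j*u*r : ∀ j e {u r} → p ^ e ∣ r → p ^ (j + e) ∣ p ^ j * u * r
  p^e∣r⇒p^[j+e]∣p^j*u*r j e {u} {r} p^e∣r = subst₂ _∣_ (sym (^-distribˡ-+-* p j e)) (sym (*-assoc (p ^ j) u r))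
    (*-monoʳ-∣ (p ^ j) (∣n⇒∣m*n u p^e∣r))

-- The walk killed at 0

module Walk (n : ℕ) .{{_ : NonZero n}} where

  isZero isNonZero : ℕ → ℕ
  isZero    y = if y ≡ᵇ 0 then 1 else 0
  isNonZero y = if y ≡ᵇ 0 then 0 else 1

  step : (ℕ → ℕ) → ℕ → ℕ
  step f y = if y ≡ᵇ 0 then 0 else ∑[ r < n ] f ((y * r) % n)

  -- pathSum N f x sums f(x_N) over the step sequences r₁ … r_N whose trajectory
  -- x = x₀, x₁, … avoids 0 before time N.
  pathSum : ℕ → (ℕ → ℕ) → ℕ → ℕ
  pathSum zero    f = f
  pathSum (suc N) f = step (pathSum N f)

  module _ {f g : ℕ → ℕ} where

    step-cong : (∀ y → y < n → f y ≡ g y) → ∀ x → step f x ≡ step g x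
    step-cong f≗g x with x ≡ᵇ 0
    ... | true  = refl
    ... | false = ∑-cong n (λ r _ → f≗g _ (m%n<n (x * r) n))

    step-+ : ∀ x → step (λ y → f y + g y) x ≡ step f x + step g x
    step-+ x with x ≡ᵇ 0
    ... | true  = refl
    ... | false = ∑-distrib-+ n _ _

    step-mono-≤ : (∀ y → f y ≤ g y) → ∀ x → step f x ≤ step g x
    step-mono-≤ f≤g x with x ≡ᵇ 0
    ... | true  = z≤n
    ... | false = ∑-mono-≤ n (λ r → f≤g _)

  step-* : ∀ c (f : ℕ → ℕ) x → step (λ y → c * f y) x ≡ c * step f x
  step-* c f x with x ≡ᵇ 0
  ... | true  = sym (*-zeroʳ c)
  ... | false = sym (*-distribˡ-∑ n c _)

  module _ {f g : ℕ → ℕ} where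

    pathSum-cong : (∀ y → y < n → f y ≡ g y) → ∀ N x → x < n → pathSum N f x ≡ pathSum N g x
    pathSum-cong f≗g zero    x x<n = f≗g x x<n
    pathSum-cong f≗g (suc N) x _   = step-cong (pathSum-cong f≗g N) x

    pathSum-+ : ∀ N x → pathSum N (λ y → f y + g y) x ≡ pathSum N f x + pathSum N g x
    pathSum-+ zero    x = refl
    pathSum-+ (suc N) x = trans (step-cong (λ y _ → pathSum-+ N y) x) (step-+ {pathSum N f} {pathSum N g} x)

    pathSum-mono-≤ : (∀ y → f y ≤ g y) → ∀ N x → pathSum N f x ≤ pathSum N g x
    pathSum-mono-≤ f≤g zero    x = f≤g x
    pathSum-mono-≤ f≤g (suc N) x = step-mono-≤ (pathSum-mono-≤ f≤g N) x

  pathSum-* : ∀ c (f : ℕ → ℕ) N x → pathSum N (λ y → c * f y) x ≡ c * pathSum N f x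
  pathSum-* c f zero    x = refl
  pathSum-* c f (suc N) x = trans (step-cong (λ y _ → pathSum-* c f N y) x) (step-* c (pathSum N f) x)

  pathSum-suc : ∀ N f x → pathSum (suc N) f x ≡ pathSum N (step f) x
  pathSum-suc zero    f x = refl
  pathSum-suc (suc N) f x = step-cong (λ y _ → pathSum-suc N f y) x

  step-isNonZero+step-isZero : ∀ y → step isNonZero y + step isZero y ≡ n * isNonZero y
  step-isNonZero+step-isZero y with y ≡ᵇ 0
  ... | true  = sym (*-zeroʳ n)
  ... | false = begin
    ∑[ r < n ] isNonZero ((y * r) % n) + ∑[ r < n ] isZero ((y * r) % n)  ≡⟨ ∑-distrib-+ n _ _ ⟨
    ∑[ r < n ] (isNonZero ((y * r) % n) + isZero ((y * r) % n))          ≡⟨ ∑-cong n (λ r _ → isNonZero+isZero ((y * r) % n)) ⟩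
    ∑[ r < n ] 1                                                          ≡⟨ ∑-const n 1 ⟩
    n * 1                                                                 ∎
    where
    open ≡-Reasoning
    isNonZero+isZero : ∀ z → isNonZero z + isZero z ≡ 1
    isNonZero+isZero z with z ≡ᵇ 0
    ... | true  = refl
    ... | false = refl

  pathSum-isNonZero+isZero : ∀ N x → x < n →
    pathSum (suc N) isNonZero x + pathSum (suc N) isZero x ≡ n * pathSum N isNonZero x
  pathSum-isNonZero+isZero N x x<n = begin
    pathSum (suc N) isNonZero x + pathSum (suc N) isZero x
      ≡⟨ cong₂ _+_ (pathSum-suc N isNonZero x) (pathSum-suc N isZero x) ⟩
    pathSum N (step isNonZero) x + pathSum N (step isZero) x
      ≡⟨ pathSum-+ N x ⟨
    pathSum N (λ y → step isNonZero y + step isZero y) x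
      ≡⟨ pathSum-cong (λ y _ → step-isNonZero+step-isZero y) N x x<n ⟩
    pathSum N (λ y → n * isNonZero y) x
      ≡⟨ pathSum-* n isNonZero N x ⟩
    n * pathSum N isNonZero x ∎
    where open ≡-Reasoning

  pathSum-harmonic : ∀ (h : ℕ → ℕ) → (∀ y → y < n → step h y + n * isNonZero y ≡ n * h y) →
    ∀ N x → x < n → pathSum (suc N) h x + n * pathSum N isNonZero x ≡ n * pathSum N h x
  pathSum-harmonic h harmonic N x x<n = begin
    pathSum (suc N) h x + n * pathSum N isNonZero x
      ≡⟨ cong₂ _+_ (pathSum-suc N h x) (sym (pathSum-* n isNonZero N x)) ⟩
    pathSum N (step h) x + pathSum N (λ y → n * isNonZero y) x
      ≡⟨ pathSum-+ N x ⟨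
    pathSum N (λ y → step h y + n * isNonZero y) x
      ≡⟨ pathSum-cong harmonic N x x<n ⟩
    pathSum N (λ y → n * h y) x
      ≡⟨ pathSum-* n h N x ⟩
    n * pathSum N h x ∎
    where open ≡-Reasoning

  pathSum-isNonZero-0 : ∀ N → pathSum N isNonZero 0 ≡ 0
  pathSum-isNonZero-0 zero    = refl
  pathSum-isNonZero-0 (suc N) = refl

  pathSum-isNonZero≤ : ∀ N x → pathSum N isNonZero x ≤ (n ∸ 1) ^ N
  pathSum-isNonZero≤ zero x with x ≡ᵇ 0
  ... | true  = z≤n
  ... | false = ≤-refl
  pathSum-isNonZero≤ (suc N) x with x ≡ᵇ 0
  ... | true  = z≤n
  ... | false = ∑-≤-[m∸1]* n _ _
    (trans (cong (λ z → pathSum N isNonZero (z % n)) (*-zeroʳ x))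
      (trans (cong (pathSum N isNonZero) (m*n%n≡0 0 n)) (pathSum-isNonZero-0 N)))
    (λ r → pathSum-isNonZero≤ N _)

  firstHitCount : ℕ → ℕ → ℕ
  firstHitCount t x = length (filterᵇ (λ rs → firstHitAtEnd (run n x rs)) (allSeqs n t))

  firstHitCount≡pathSum-isZero : ∀ t x → firstHitCount t x ≡ pathSum t isZero x
  firstHitCount≡pathSum-isZero zero x with x ≡ᵇ 0
  ... | true  = refl
  ... | false = refl
  firstHitCount≡pathSum-isZero (suc t) x = begin
    firstHitCount (suc t) x
      ≡⟨ length-filterᵇ-concatMap P _ (upTo n) ⟩
    sum (map (λ r → length (filterᵇ P (map (r ∷_) (allSeqs n t)))) (upTo n))
      ≡⟨ sum-map-upTo n _ ⟩
    ∑[ r < n ] length (filterᵇ P (map (r ∷_) (allSeqs n t)))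
      ≡⟨ ∑-cong n (λ r _ → trans (length-filterᵇ-map P (r ∷_) (allSeqs n t))
                                 (length-filterᵇ-cong (firstHitAtEnd-∷ r) (allSeqs n t))) ⟩
    ∑[ r < n ] length (filterᵇ (λ rs → not (x ≡ᵇ 0) ∧ firstHitAtEnd (run n ((x * r) % n) rs)) (allSeqs n t))
      ≡⟨ killAt0 ⟩
    pathSum (suc t) isZero x ∎
    where
    open ≡-Reasoning
    P : List ℕ → Bool
    P rs = firstHitAtEnd (run n x rs)
    firstHitAtEnd-∷ : ∀ r rs → P (r ∷ rs) ≡ not (x ≡ᵇ 0) ∧ firstHitAtEnd (run n ((x * r) % n) rs)
    firstHitAtEnd-∷ r []       = refl
    firstHitAtEnd-∷ r (_ ∷ _)  = refl
    killAt0 : ∑[ r < n ] length (filterᵇ (λ rs → not (x ≡ᵇ 0) ∧ firstHitAtEnd (run n ((x * r) % n) rs)) (allSeqs n t))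
            ≡ pathSum (suc t) isZero x
    killAt0 with x ≡ᵇ 0
    ... | true  = trans (∑-cong n (λ r _ → length-filterᵇ-false (allSeqs n t))) (trans (∑-const n 0) (*-zeroʳ n))
    ... | false = ∑-cong n (λ r _ → firstHitCount≡pathSum-isZero t _)

-- Bernoulli-type inequalities

bernoulli : ∀ a N → a ^ N * (a + N) ≤ a * suc a ^ N
bernoulli a zero    = ≤-reflexive (trans (+-identityʳ (a + 0)) (trans (+-identityʳ a) (sym (*-identityʳ a))))
bernoulli a (suc N) = begin
  a ^ suc N * (a + suc N)               ≡⟨ expand a (a ^ N) N ⟩
  a * (a ^ N * (a + N)) + a * a ^ N     ≤⟨ +-mono-≤ (*-monoʳ-≤ a (bernoulli a N)) (*-monoʳ-≤ a (^-monoˡ-≤ N (n≤1+n a))) ⟩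
  a * (a * suc a ^ N) + a * suc a ^ N   ≡⟨ collect a (suc a ^ N) ⟩
  a * suc a ^ suc N                     ∎
  where
  open ≤-Reasoning
  expand : ∀ a A N → a * A * (a + suc N) ≡ a * (A * (a + N)) + a * A
  expand = solve-∀
  collect : ∀ a B → a * (a * B) + a * B ≡ a * (suc a * B)
  collect = solve-∀

bernoulli² : ∀ a N → 1 ≤ a → a ^ N * (N * N) ≤ 2 * a * a * suc a ^ N
bernoulli² a zero    _   = z≤n
bernoulli² a (suc N) 1≤a = begin
  a ^ suc N * (suc N * suc N)                          ≡⟨ expand a (a ^ N) N ⟩
  a * (a ^ N * (N * N)) + a * (a ^ N * (1 + 2 * N))    ≤⟨ +-mono-≤ (*-monoʳ-≤ a (bernoulli² a N 1≤a)) (*-monoʳ-≤ a linear) ⟩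
  a * (2 * a * a * suc a ^ N) + a * (2 * (a * suc a ^ N))  ≡⟨ collect a (suc a ^ N) ⟩
  2 * a * a * suc a ^ suc N                            ∎
  where
  open ≤-Reasoning
  expand : ∀ a A N → a * A * (suc N * suc N) ≡ a * (A * (N * N)) + a * (A * (1 + 2 * N))
  expand = solve-∀
  collect : ∀ a B → a * (2 * a * a * B) + a * (2 * (a * B)) ≡ 2 * a * a * (suc a * B)
  collect = solve-∀
  linear : a ^ N * (1 + 2 * N) ≤ 2 * (a * suc a ^ N)
  linear = begin
    a ^ N * (1 + 2 * N)    ≤⟨ *-monoʳ-≤ (a ^ N) (+-monoˡ-≤ (2 * N) (≤-trans 1≤a (m≤n*m a 2))) ⟩
    a ^ N * (2 * a + 2 * N) ≡⟨ cong (a ^ N *_) (*-distribˡ-+ 2 a N) ⟨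
    a ^ N * (2 * (a + N))   ≡⟨ *-comm (a ^ N) _ ⟩
    2 * (a + N) * a ^ N     ≡⟨ *-assoc 2 (a + N) (a ^ N) ⟩
    2 * ((a + N) * a ^ N)   ≡⟨ cong (2 *_) (*-comm (a + N) (a ^ N)) ⟩
    2 * (a ^ N * (a + N))   ≤⟨ *-monoʳ-≤ 2 (bernoulli a N) ⟩
    2 * (a * suc a ^ N)     ∎

pow-dominates-linear : ∀ a c N → 1 ≤ a → 2 * a * c < N → a ^ N * N * c < a * suc a ^ N
pow-dominates-linear a c N 1≤a 2ac<N = *-cancelʳ-< N _ _ (begin-strict
  a ^ N * N * c * N              ≡⟨ shuffle (a ^ N) N c ⟩
  a ^ N * (N * N) * c            ≤⟨ *-monoˡ-≤ c (bernoulli² a N 1≤a) ⟩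
  2 * a * a * suc a ^ N * c      ≡⟨ regroup a (suc a ^ N) c ⟩
  a * suc a ^ N * (2 * a * c)    <⟨ *-monoʳ-< (a * suc a ^ N) 2ac<N ⟩
  a * suc a ^ N * N              ∎)
  where
  open ≤-Reasoning
  instance _ = m*n≢0 a (suc a ^ N) {{ℕ.>-nonZero 1≤a}} {{m^n≢0 (suc a) N}}
  shuffle : ∀ A N c → A * N * c * N ≡ A * (N * N) * c
  shuffle = solve-∀
  regroup : ∀ a B c → 2 * a * a * B * c ≡ a * B * (2 * a * c)
  regroup = solve-∀

negligible-vs-pow : ∀ a c (t : ℕ → ℕ) → 1 ≤ a → (∀ M → a * t (suc M) ≤ a ^ suc M * suc M * c) →
  ∀ m → ∃[ N₀ ] ∀ N → N₀ ≤ N → t N * m < suc a ^ N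
negligible-vs-pow a c t 1≤a t≤ m = suc (2 * a * (c * m)) , λ { (suc M) N₀≤N → *-cancelˡ-< a _ _ (begin-strict
  a * (t (suc M) * m)               ≡⟨ *-assoc a (t (suc M)) m ⟨
  a * t (suc M) * m                 ≤⟨ *-monoˡ-≤ m (t≤ M) ⟩
  a ^ suc M * suc M * c * m         ≡⟨ *-assoc (a ^ suc M * suc M) c m ⟩
  a ^ suc M * suc M * (c * m)       <⟨ pow-dominates-linear a (c * m) (suc M) 1≤a N₀≤N ⟩
  a * suc a ^ suc M                 ∎) }
  where open ≤-Reasoning

-- Rationals and the expectation series

-- Imported only here: from now on `+_` is the embedding ℕ → ℤ, not a section of ℕ addition.
open import Data.Integer as ℤ using (+_)
import Data.Integer.Properties as ℤP
open import Data.Rational as ℚ using (ℚ; _/_; toℚᵘ; mkℚ; 0ℚ; ↧ₙ_; ∣_∣)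
import Data.Rational.Properties as ℚP
open import Algebra.Properties.AbelianGroup ℚP.+-0-abelianGroup using (⁻¹-anti-homo‿-; xyx⁻¹≈y)
import Data.Rational.Unnormalised as ℚᵘ
import Data.Rational.Unnormalised.Properties as ℚᵘP

toℚᵘ-/ : ∀ i d .{{_ : NonZero d}} → toℚᵘ (i / d) ℚᵘ.≃ i ℚᵘ./ d
toℚᵘ-/ i (suc d) = ℚP.toℚᵘ-fromℚᵘ (ℚᵘ.mkℚᵘ i d)

/-cross : ∀ a b c d .{{_ : NonZero b}} .{{_ : NonZero d}} → a * d ≡ c * b → + a / b ≡ + c / d
/-cross a b@(suc _) c d@(suc _) ad≡cb = ℚP.toℚᵘ-injective
  (ℚᵘP.≃-trans (toℚᵘ-/ (+ a) b) (ℚᵘP.≃-trans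
    (ℚᵘ.*≡* (trans (sym (ℤP.pos-* a d)) (trans (cong +_ ad≡cb) (ℤP.pos-* c b))))
    (ℚᵘP.≃-sym (toℚᵘ-/ (+ c) d))))

/-+-/ : ∀ a b c d .{{_ : NonZero b}} .{{_ : NonZero d}} →
  + a / b ℚ.+ + c / d ≡ (+ (a * d + c * b) / (b * d)) {{m*n≢0 b d}}
/-+-/ a b@(suc _) c d@(suc _) = ℚP.toℚᵘ-injective
  (ℚᵘP.≃-trans (ℚP.toℚᵘ-homo-+ (+ a / b) (+ c / d)) (ℚᵘP.≃-trans
    (ℚᵘP.+-cong (toℚᵘ-/ (+ a) b) (toℚᵘ-/ (+ c) d)) (ℚᵘP.≃-trans
    (ℚᵘP.≃-reflexive (cong (ℚᵘ._/ (b * d)) (trans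
      (cong₂ ℤ._+_ (sym (ℤP.pos-* a d)) (sym (ℤP.pos-* c b))) (sym (ℤP.pos-+ (a * d) (c * b))))))
    (ℚᵘP.≃-sym (toℚᵘ-/ (+ (a * d + c * b)) (b * d))))))

/1-*-/ : ∀ a c d .{{_ : NonZero d}} → (+ a / 1) ℚ.* (+ c / d) ≡ + (a * c) / d
/1-*-/ a c d@(suc d′) = ℚP.toℚᵘ-injective
  (ℚᵘP.≃-trans (ℚP.toℚᵘ-homo-* (+ a / 1) (+ c / d)) (ℚᵘP.≃-trans
    (ℚᵘP.*-cong (toℚᵘ-/ (+ a) 1) (toℚᵘ-/ (+ c) d)) (ℚᵘP.≃-trans
    (ℚᵘ.*≡* (cong₂ ℤ._*_ (sym (ℤP.pos-* a c)) (cong (λ e → + suc e) (sym (+-identityʳ d′)))))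
    (ℚᵘP.≃-sym (toℚᵘ-/ (+ (a * c)) d)))))

/-telescope : ∀ N C R R′ m P .{{_ : NonZero m}} .{{_ : NonZero P}} → m * R ≡ R′ + m * (N * C) →
  (+ N / 1) ℚ.* (+ C / P) ℚ.+ (+ R′ / (m * P)) {{m*n≢0 m P}} ≡ + R / P
/-telescope N C R R′ m P eq = begin
  (+ N / 1) ℚ.* (+ C / P) ℚ.+ + R′ / (m * P)               ≡⟨ cong (λ x → x ℚ.+ + R′ / (m * P)) (/1-*-/ N C P) ⟩
  + (N * C) / P ℚ.+ + R′ / (m * P)                          ≡⟨ /-+-/ (N * C) P R′ (m * P) ⟩
  + (N * C * (m * P) + R′ * P) / (P * (m * P))              ≡⟨ /-cross (N * C * (m * P) + R′ * P) (P * (m * P)) R P cross ⟩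
  + R / P                                                    ∎
  where
  open ≡-Reasoning
  instance
    mP≢0  = m*n≢0 m P
    PmP≢0 = m*n≢0 P (m * P)
  cross : (N * C * (m * P) + R′ * P) * P ≡ R * (P * (m * P))
  cross = begin
    (N * C * (m * P) + R′ * P) * P  ≡⟨ expandˡ N C m P R′ ⟩
    P * P * (R′ + m * (N * C))      ≡⟨ cong (P * P *_) eq ⟨
    P * P * (m * R)                 ≡⟨ expandʳ P m R ⟩
    R * (P * (m * P))               ∎
    where
    expandˡ : ∀ N C m P R′ → (N * C * (m * P) + R′ * P) * P ≡ P * P * (R′ + m * (N * C))
    expandˡ = solve-∀
    expandʳ : ∀ P m R → P * P * (m * R) ≡ R * (P * (m * P))
    expandʳ = solve-∀

∣p-[p+q]∣≡∣q∣ : ∀ p q → ∣ p ℚ.- (p ℚ.+ q) ∣ ≡ ∣ q ∣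
∣p-[p+q]∣≡∣q∣ p q = begin
  ∣ p ℚ.- (p ℚ.+ q) ∣      ≡⟨ ℚP.∣-p∣≡∣p∣ _ ⟨
  ∣ ℚ.- (p ℚ.- (p ℚ.+ q)) ∣  ≡⟨ cong ∣_∣ (⁻¹-anti-homo‿- p (p ℚ.+ q)) ⟩
  ∣ p ℚ.+ q ℚ.- p ∣        ≡⟨ cong ∣_∣ (xyx⁻¹≈y p q) ⟩
  ∣ q ∣                  ∎
  where open ≡-Reasoning


/<-pos : ∀ r P .{{_ : NonZero P}} ε → 0ℚ ℚ.< ε → r * ↧ₙ ε < P → + r / P ℚ.< ε
/<-pos r P (mkℚ (+ 0) _ _)          0<ε _ with () ← ℚ.positive 0<ε
/<-pos r P (mkℚ ℤ.-[1+ _ ] _ _)     0<ε _ with () ← ℚ.positive 0<ε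
/<-pos r P@(suc _) ε@(mkℚ ℤ.+[1+ k ] d _) _ r↧ε<P =
  ℚP.toℚᵘ-cancel-< (ℚᵘP.<-respˡ-≃ (ℚᵘP.≃-sym (toℚᵘ-/ (+ r) P)) cross)
  where
  cross : + r ℚᵘ./ P ℚᵘ.< toℚᵘ ε
  cross = ℚᵘ.*<* (subst₂ ℤ._<_ (ℤP.pos-* r (suc d)) (ℤP.pos-* (suc k) P)
      (ℤ.+<+ (<-≤-trans r↧ε<P (m≤n*m P (suc k)))))

module _ (n : ℕ) .{{n≢0 : NonZero n}} where
  infixl 7 _/n^_
  _/n^_ : ℤ.ℤ → ℕ → ℚ
  i /n^ N = (i / n ^ N) {{m^n≢0 n N}}

  partialExp+tail : ∀ v (hits tail : ℕ → ℕ) →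
    (∀ N → probHit n N ≡ + hits N /n^ N) → tail 0 ≡ v →
    (∀ N → n * tail N ≡ tail (suc N) + n * (N * hits N)) →
    ∀ N → partialExp n N ℚ.+ + tail N /n^ N ≡ + v / 1
  partialExp+tail v hits tail probHit≡ tail-0 tail-suc = go
    where
    open ≡-Reasoning
    go : ∀ N → partialExp n N ℚ.+ + tail N /n^ N ≡ + v / 1
    go zero    = trans (ℚP.+-identityˡ _) (cong (λ t → + t / 1) tail-0)
    go (suc N) = begin
      partialExp n N ℚ.+ (+ N / 1) ℚ.* probHit n N ℚ.+ + tail (suc N) /n^ suc N
        ≡⟨ ℚP.+-assoc (partialExp n N) _ _ ⟩
      partialExp n N ℚ.+ ((+ N / 1) ℚ.* probHit n N ℚ.+ + tail (suc N) /n^ suc N)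
        ≡⟨ cong (λ p → partialExp n N ℚ.+ ((+ N / 1) ℚ.* p ℚ.+ + tail (suc N) /n^ suc N)) (probHit≡ N) ⟩
      partialExp n N ℚ.+ ((+ N / 1) ℚ.* (+ hits N /n^ N) ℚ.+ + tail (suc N) /n^ suc N)
        ≡⟨ cong (ℚ._+_ (partialExp n N)) (/-telescope N (hits N) (tail N) (tail (suc N)) n (n ^ N) {{n≢0}} {{m^n≢0 n N}} (tail-suc N)) ⟩
      partialExp n N ℚ.+ + tail N /n^ N
        ≡⟨ go N ⟩
      + v / 1 ∎

  expectedHittingTime-tail : ∀ v (tail : ℕ → ℕ) →
    (∀ N → partialExp n N ℚ.+ + tail N /n^ N ≡ + v / 1) →
    (∀ m → ∃[ N₀ ] ∀ N → N₀ ≤ N → tail N * m < n ^ N) →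
    ExpectedHittingTime n (+ v / 1)
  expectedHittingTime-tail v tail partialExp+tail≡v tail→0 ε 0<ε =
    proj₁ (tail→0 (↧ₙ ε)) , λ N N₀≤N →
      subst (ℚ._< ε) (sym (distance N)) (/<-pos (tail N) (n ^ N) {{m^n≢0 n N}} ε 0<ε (proj₂ (tail→0 (↧ₙ ε)) N N₀≤N))
    where
    open ≡-Reasoning
    distance : ∀ N → ∣ partialExp n N ℚ.- + v / 1 ∣ ≡ + tail N /n^ N
    distance N = begin
      ∣ partialExp n N ℚ.- + v / 1 ∣                                ≡⟨ cong (λ w → ∣ partialExp n N ℚ.- w ∣) (partialExp+tail≡v N) ⟨
      ∣ partialExp n N ℚ.- (partialExp n N ℚ.+ + tail N /n^ N) ∣  ≡⟨ ∣p-[p+q]∣≡∣q∣ (partialExp n N) (+ tail N /n^ N) ⟩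
      ∣ + tail N /n^ N ∣                                        ≡⟨ ℚP.0≤p⇒∣p∣≡p (ℚP.nonNegative⁻¹ _ {{ℚP.normalize-nonNeg (tail N) (n ^ N) {{m^n≢0 n N}}}}) ⟩
      + tail N /n^ N                                           ∎

  open Walk n

  expectedHittingTime-harmonic : 1 < n → (h : ℕ → ℕ) (v : ℕ) → h 0 ≡ 0 → (∀ y → h y ≤ v) →
    (∀ y → 0 < y → y < n → ∑[ r < n ] h ((y * r) % n) + n ≡ n * h y) →
    ExpectedHittingTime n (+ h (1 % n) / 1)
  expectedHittingTime-harmonic 1<n h v h0≡0 h≤v harmonic =
    expectedHittingTime-tail (h x₀) tail (partialExp+tail (h x₀) hits tail probHit≡ refl tail-suc)
      (λ m → subst (λ b → ∃[ N₀ ] ∀ N → N₀ ≤ N → tail N * m < b ^ N) suc[n∸1]≡n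
        (negligible-vs-pow a (suc a + a * v) tail 1≤a tail-bound m))
    where
    x₀ = 1 % n
    a  = n ∸ 1

    suc[n∸1]≡n : suc a ≡ n
    suc[n∸1]≡n = m+[n∸m]≡n (<⇒≤ 1<n)

    1≤a : 1 ≤ a
    1≤a = ≤-pred (subst (2 ≤_) (sym suc[n∸1]≡n) 1<n)

    survivors hits remaining tail : ℕ → ℕ
    survivors N = pathSum N isNonZero x₀
    hits      N = pathSum N isZero x₀
    remaining N = pathSum N h x₀
    -- tail N / n ^ N is the part E[T ; T ≥ N] of the expectation not yet summed up at time N.
    tail      N = N * (survivors N + hits N) + remaining N

    probHit≡ : ∀ N → probHit n N ≡ + hits N /n^ N
    probHit≡ N = cong (λ c → + c /n^ N) (firstHitCount≡pathSum-isZero N x₀)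

    h-step : ∀ y → y < n → step h y + n * isNonZero y ≡ n * h y
    h-step zero    _   = cong (n *_) (sym h0≡0)
    h-step (suc y) y<n = trans (cong (_+_ (step h (suc y))) (*-identityʳ n)) (harmonic (suc y) (s≤s z≤n) y<n)

    h≤v*isNonZero : ∀ y → h y ≤ v * isNonZero y
    h≤v*isNonZero zero    = ≤-reflexive (trans h0≡0 (sym (*-zeroʳ v)))
    h≤v*isNonZero (suc y) = ≤-trans (h≤v (suc y)) (≤-reflexive (sym (*-identityʳ v)))

    survivors-suc : ∀ N → survivors (suc N) + hits (suc N) ≡ n * survivors N
    survivors-suc N = pathSum-isNonZero+isZero N x₀ (m%n<n 1 n)

    remaining-suc : ∀ N → remaining (suc N) + n * survivors N ≡ n * remaining N
    remaining-suc N = pathSum-harmonic h h-step N x₀ (m%n<n 1 n)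

    tail-suc : ∀ N → n * tail N ≡ tail (suc N) + n * (N * hits N)
    tail-suc N = begin
      n * (N * (S + C) + H)                  ≡⟨ *-distribˡ-+ n _ H ⟩
      n * (N * (S + C)) + n * H              ≡⟨ cong (_+_ (n * (N * (S + C)))) (remaining-suc N) ⟨
      n * (N * (S + C)) + (H′ + n * S)       ≡⟨ regroup n N S C H′ ⟩
      suc N * (n * S) + H′ + n * (N * C)     ≡⟨ cong (λ x → suc N * x + H′ + n * (N * C)) (survivors-suc N) ⟨
      suc N * (S′ + C′) + H′ + n * (N * C)   ∎
      where
      open ≡-Reasoning
      S = survivors N; C = hits N; H = remaining N
      S′ = survivors (suc N); C′ = hits (suc N); H′ = remaining (suc N)
      regroup : ∀ n N S C H′ → n * (N * (S + C)) + (H′ + n * S) ≡ suc N * (n * S) + H′ + n * (N * C)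
      regroup = solve-∀

    tail-bound : ∀ M → a * tail (suc M) ≤ a ^ suc M * suc M * (suc a + a * v)
    tail-bound M = begin
      a * (N * (survivors N + hits N) + remaining N)
        ≡⟨ cong (λ x → a * (N * x + remaining N)) (trans (survivors-suc M) (cong (_* survivors M) (sym suc[n∸1]≡n))) ⟩
      a * (N * (suc a * survivors M) + remaining N)
        ≤⟨ *-monoʳ-≤ a (+-mono-≤ (*-monoʳ-≤ N (*-monoʳ-≤ (suc a) (pathSum-isNonZero≤ M x₀))) remaining≤) ⟩
      a * (N * (suc a * a ^ M) + v * (a * a ^ M))
        ≡⟨ distribute a N (a ^ M) v ⟩
      N * (a * a ^ M) * suc a + a * v * (a * a ^ M)
        ≤⟨ +-monoʳ-≤ (N * (a * a ^ M) * suc a) (m≤n*m _ N) ⟩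
      N * (a * a ^ M) * suc a + N * (a * v * (a * a ^ M))
        ≡⟨ factor (a * a ^ M) N a v ⟩
      a * a ^ M * N * (suc a + a * v)
        ∎
      where
      open ≤-Reasoning
      N = suc M
      remaining≤ : remaining N ≤ v * (a * a ^ M)
      remaining≤ = ≤-trans (pathSum-mono-≤ h≤v*isNonZero N x₀)
                 (≤-trans (≤-reflexive (pathSum-* v isNonZero N x₀)) (*-monoʳ-≤ v (pathSum-isNonZero≤ N x₀)))
      distribute : ∀ a N A v → a * (N * (suc a * A) + v * (a * A)) ≡ N * (a * A) * suc a + a * v * (a * A)
      distribute = solve-∀
      factor : ∀ B N a v → N * B * suc a + N * (a * v * B) ≡ B * N * (suc a + a * v)
      factor = solve-∀

-- Prime powers

module PrimePower (p k : ℕ) (pr : Prime p) where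
  n q : ℕ
  n = p ^ k
  q = p ∸ 1

  instance
    p≢0 : NonZero p
    p≢0 = prime⇒nonZero pr
    n≢0 : NonZero n
    n≢0 = m^n≢0 p k

  1<p : 1 < p
  1<p = ℕ.nonTrivial⇒n>1 p {{prime⇒nonTrivial pr}}

  p≡1+q : p ≡ suc q
  p≡1+q = sym (m+[n∸m]≡n (<⇒≤ 1<p))

  p^i∣p^j : ∀ {i j} → i ≤ j → p ^ i ∣ p ^ j
  p^i∣p^j {i} {j} i≤j = divides (p ^ (j ∸ i))
    (trans (cong (p ^_) (sym (m+[n∸m]≡n i≤j))) (trans (^-distribˡ-+-* p i (j ∸ i)) (*-comm (p ^ i) _)))

  -- For y = p ^ j * u with p ∤ u and j < k this is 1 + q (k ∸ j), the expected absorption time from y.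
  h : ℕ → ℕ
  h y = 𝟙 (¬? (n ∣? y)) + q * ∑[ i < k ] 𝟙 (¬? (p ^ suc i ∣? y))

  h-mod : ∀ y → h (y % n) ≡ h y
  h-mod y = cong₂ (λ a b → a + q * b) (𝟙¬∣-mod ∣-refl)
                                      (∑-cong k (λ i i<k → 𝟙¬∣-mod (p^i∣p^j i<k)))
    where
    𝟙¬∣-mod : ∀ {d} → d ∣ n → 𝟙 (¬? (d ∣? y % n)) ≡ 𝟙 (¬? (d ∣? y))
    𝟙¬∣-mod d∣n = 𝟙-⇔ (¬? (_ ∣? _)) (¬? (_ ∣? _)) (λ ¬d∣y% d∣y → ¬d∣y% (%-presˡ-∣ d∣y d∣n))
                                                  (λ ¬d∣y d∣y% → ¬d∣y (∣n∣m%n⇒∣m d∣n d∣y%))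

  module Valuation (j u : ℕ) (p∤u : ¬ p ∣ u) where

    y : ℕ
    y = p ^ j * u

    divisible notDivisible : ℕ → ℕ
    divisible    e = ∑[ r < n ] 𝟙 (p ^ e ∣? y * r)
    notDivisible e = ∑[ r < n ] 𝟙 (¬? (p ^ e ∣? y * r))

    divisible+notDivisible : ∀ e → divisible e + notDivisible e ≡ n
    divisible+notDivisible e = begin
      divisible e + notDivisible e  ≡⟨ ∑-distrib-+ n _ _ ⟨
      ∑[ r < n ] (𝟙 (p ^ e ∣? y * r) + 𝟙 (¬? (p ^ e ∣? y * r)))  ≡⟨ ∑-cong n (λ r _ → 𝟙+𝟙¬ (p ^ e ∣? y * r)) ⟩
      ∑[ r < n ] 1                  ≡⟨ ∑-const n 1 ⟩
      n * 1                         ≡⟨ *-identityʳ n ⟩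
      n                             ∎
      where open ≡-Reasoning

    divisible-low : ∀ e → e ≤ j → divisible e ≡ n
    divisible-low e e≤j = trans (∑-cong n (λ r _ → 𝟙-yes (p ^ e ∣? y * r) (p^e∣y*r r)))
                                (trans (∑-const n 1) (*-identityʳ n))
      where
      p^e∣y*r : ∀ r → p ^ e ∣ y * r
      p^e∣y*r r = ∣-trans (p^i∣p^j e≤j) (∣-trans (m∣m*n u) (m∣m*n r))

    divisible-high : ∀ d → d ≤ k → divisible (j + d) ≡ p ^ (k ∸ d)
    divisible-high d d≤k = begin
      divisible (j + d)
        ≡⟨ ∑-cong n (λ r _ → 𝟙-⇔ (p ^ (j + d) ∣? y * r) (p ^ d ∣? r)
                                (p^[j+e]∣p^j*u*r⇒p^e∣r pr j d p∤u) (p^e∣r⇒p^[j+e]∣p^j*u*r pr j d)) ⟩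
      ∑[ r < n ] 𝟙 (p ^ d ∣? r)
        ≡⟨ cong (λ l → ∑[ r < l ] 𝟙 (p ^ d ∣? r)) n≡p^d*p^[k∸d] ⟩
      ∑[ r < p ^ d * p ^ (k ∸ d) ] 𝟙 (p ^ d ∣? r)
        ≡⟨ ∑-multiples (p ^ d) (p ^ (k ∸ d)) {{m^n≢0 p d}} ⟩
      p ^ (k ∸ d)
        ∎
      where
      open ≡-Reasoning
      n≡p^d*p^[k∸d] : n ≡ p ^ d * p ^ (k ∸ d)
      n≡p^d*p^[k∸d] = trans (cong (p ^_) (sym (m+[n∸m]≡n d≤k))) (^-distribˡ-+-* p d (k ∸ d))

    divisible-step : ∀ i → i < k →
      q * notDivisible (suc i) + divisible i ≡ divisible (suc i) + q * n * 𝟙 (¬? (p ^ suc i ∣? y))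
    divisible-step i i<k with suc i ≤? j
    ... | yes 1+i≤j = begin
      q * notDivisible (suc i) + divisible i
        ≡⟨ cong₂ (λ a b → q * a + b) none (divisible-low i (≤-trans (n≤1+n i) 1+i≤j)) ⟩
      q * 0 + n
        ≡⟨ trans (cong (_+ n) (*-zeroʳ q)) (sym (+-identityʳ n)) ⟩
      n + 0
        ≡⟨ cong₂ _+_ (divisible-low (suc i) 1+i≤j) (*-zeroʳ (q * n)) ⟨
      divisible (suc i) + q * n * 0
        ≡⟨ cong (λ b → divisible (suc i) + q * n * b) (𝟙-no (¬? (_ ∣? y)) (λ p^[1+i]∤y → p^[1+i]∤y p^[1+i]∣y)) ⟨
      divisible (suc i) + q * n * 𝟙 (¬? (p ^ suc i ∣? y))
        ∎
      where
      open ≡-Reasoning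
      p^[1+i]∣y : p ^ suc i ∣ y
      p^[1+i]∣y = ∣-trans (p^i∣p^j 1+i≤j) (m∣m*n u)
      none : notDivisible (suc i) ≡ 0
      none = +-cancelˡ-≡ n _ 0 (begin
        n + notDivisible (suc i)                  ≡⟨ cong (_+ notDivisible (suc i)) (divisible-low (suc i) 1+i≤j) ⟨
        divisible (suc i) + notDivisible (suc i)  ≡⟨ divisible+notDivisible (suc i) ⟩
        n                                         ≡⟨ +-identityʳ n ⟨
        n + 0                                     ∎)
    ... | no 1+i≰j = begin
      q * A + divisible i                  ≡⟨ cong (λ b → q * A + b) divisible-ratio ⟩
      q * A + p * D                        ≡⟨ cong (λ b → q * A + b * D) p≡1+q ⟩
      q * A + suc q * D                    ≡⟨ regroup q A D ⟩
      D + q * (D + A)                      ≡⟨ cong (λ b → D + q * b) (divisible+notDivisible (suc i)) ⟩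
      D + q * n                            ≡⟨ cong (_+_ D) (*-identityʳ (q * n)) ⟨
      D + q * n * 1                        ≡⟨ cong (λ b → D + q * n * b) (𝟙-yes (¬? (_ ∣? y)) p^[1+i]∤y) ⟨
      D + q * n * 𝟙 (¬? (p ^ suc i ∣? y))  ∎
      where
      open ≡-Reasoning
      A = notDivisible (suc i)
      D = divisible (suc i)
      regroup : ∀ q A D → q * A + suc q * D ≡ D + q * (D + A)
      regroup = solve-∀
      d = i ∸ j
      j+d≡i : j + d ≡ i
      j+d≡i = m+[n∸m]≡n (≤-pred (≰⇒> 1+i≰j))
      j+[1+d]≡1+i : j + suc d ≡ suc i
      j+[1+d]≡1+i = trans (+-suc j d) (cong suc j+d≡i)
      1+d≤k : suc d ≤ k
      1+d≤k = m+n≤o⇒n≤o j (subst (_≤ k) (sym j+[1+d]≡1+i) i<k)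
      divisible-ratio : divisible i ≡ p * D
      divisible-ratio = begin
        divisible i                ≡⟨ cong divisible j+d≡i ⟨
        divisible (j + d)          ≡⟨ divisible-high d (≤-trans (n≤1+n d) 1+d≤k) ⟩
        p ^ (k ∸ d)                ≡⟨ cong (p ^_) (+-∸-assoc 1 1+d≤k) ⟩
        p * p ^ (k ∸ suc d)        ≡⟨ cong (p *_) (divisible-high (suc d) 1+d≤k) ⟨
        p * divisible (j + suc d)  ≡⟨ cong (λ e → p * divisible e) j+[1+d]≡1+i ⟩
        p * D                      ∎
      p^[1+i]∤y : ¬ p ^ suc i ∣ y
      p^[1+i]∤y p^[1+i]∣y = >⇒≢ (^-monoʳ-< p 1<p {0} {suc d} (s≤s z≤n)) (∣1⇒≡1 (p^[j+e]∣p^j*u*r⇒p^e∣r pr j (suc d) p∤u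
        (subst₂ (λ e m → p ^ e ∣ m) (sym j+[1+d]≡1+i) (sym (*-identityʳ y)) p^[1+i]∣y)))

    missing : ℕ
    missing = ∑[ i < k ] 𝟙 (¬? (p ^ suc i ∣? y))

    telescoped : q * ∑[ i < k ] notDivisible (suc i) + n ≡ q * n * missing + divisible k
    telescoped = +-cancelʳ-≡ Z _ _ (begin
      q * X + n + Z                      ≡⟨ +-assoc (q * X) n Z ⟩
      q * X + (n + Z)                    ≡⟨ cong (λ b → q * X + (b + Z)) (divisible-low 0 z≤n) ⟨
      q * X + (divisible 0 + Z)          ≡⟨ cong (_+_ (q * X)) (∑-telescope k divisible) ⟨
      q * X + (Y + divisible k)          ≡⟨ +-assoc (q * X) Y _ ⟨
      q * X + Y + divisible k            ≡⟨ cong (_+ divisible k) summed ⟩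
      Z + q * n * missing + divisible k  ≡⟨ rotate Z (q * n * missing) (divisible k) ⟩
      q * n * missing + divisible k + Z  ∎)
      where
      open ≡-Reasoning
      X = ∑[ i < k ] notDivisible (suc i)
      Y = ∑[ i < k ] divisible i
      Z = ∑[ i < k ] divisible (suc i)
      rotate : ∀ a b c → a + b + c ≡ b + c + a
      rotate = solve-∀
      summed : q * X + Y ≡ Z + q * n * missing
      summed = begin
        q * X + Y
          ≡⟨ cong (_+ Y) (*-distribˡ-∑ k q _) ⟩
        ∑[ i < k ] (q * notDivisible (suc i)) + Y
          ≡⟨ ∑-distrib-+ k _ _ ⟨
        ∑[ i < k ] (q * notDivisible (suc i) + divisible i)
          ≡⟨ ∑-cong k divisible-step ⟩
        ∑[ i < k ] (divisible (suc i) + q * n * 𝟙 (¬? (p ^ suc i ∣? y)))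
          ≡⟨ ∑-distrib-+ k _ _ ⟩
        Z + ∑[ i < k ] (q * n * 𝟙 (¬? (p ^ suc i ∣? y)))
          ≡⟨ cong (_+_ Z) (*-distribˡ-∑ k (q * n) _) ⟨
        Z + q * n * missing
          ∎

    ∑-h : ∑[ r < n ] h ((y * r) % n) ≡ notDivisible k + q * ∑[ i < k ] notDivisible (suc i)
    ∑-h = begin
      ∑[ r < n ] h ((y * r) % n)
        ≡⟨ ∑-cong n (λ r _ → h-mod (y * r)) ⟩
      ∑[ r < n ] h (y * r)
        ≡⟨ ∑-distrib-+ n _ _ ⟩
      notDivisible k + ∑[ r < n ] (q * ∑[ i < k ] 𝟙 (¬? (p ^ suc i ∣? y * r)))
        ≡⟨ cong (_+_ (notDivisible k)) (*-distribˡ-∑ n q _) ⟨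
      notDivisible k + q * ∑[ r < n ] ∑[ i < k ] 𝟙 (¬? (p ^ suc i ∣? y * r))
        ≡⟨ cong (λ b → notDivisible k + q * b) (∑-comm n k _) ⟩
      notDivisible k + q * ∑[ i < k ] notDivisible (suc i)
        ∎
      where open ≡-Reasoning

    h-harmonic : 0 < y → y < n → ∑[ r < n ] h ((y * r) % n) + n ≡ n * h y
    h-harmonic 0<y y<n = begin
      ∑[ r < n ] h ((y * r) % n) + n
        ≡⟨ cong (_+ n) ∑-h ⟩
      notDivisible k + q * ∑[ i < k ] notDivisible (suc i) + n
        ≡⟨ +-assoc (notDivisible k) _ n ⟩
      notDivisible k + (q * ∑[ i < k ] notDivisible (suc i) + n)
        ≡⟨ cong (_+_ (notDivisible k)) telescoped ⟩
      notDivisible k + (q * n * missing + divisible k)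
        ≡⟨ regroup (notDivisible k) (q * n * missing) (divisible k) ⟩
      divisible k + notDivisible k + q * n * missing
        ≡⟨ cong (_+ q * n * missing) (divisible+notDivisible k) ⟩
      n + q * n * missing
        ≡⟨ factor n q missing ⟩
      n * (1 + q * missing)
        ≡⟨ cong (λ b → n * (b + q * missing)) (𝟙-yes (¬? (n ∣? y)) n∤y) ⟨
      n * h y
        ∎
      where
      open ≡-Reasoning
      n∤y : ¬ n ∣ y
      n∤y n∣y = <⇒≱ y<n (∣⇒≤ {{ℕ.>-nonZero 0<y}} n∣y)
      regroup : ∀ a b c → a + (b + c) ≡ c + a + b
      regroup = solve-∀
      factor : ∀ n q w → n + q * n * w ≡ n * (1 + q * w)
      factor = solve-∀

  h-harmonic : ∀ y → 0 < y → y < n → ∑[ r < n ] h ((y * r) % n) + n ≡ n * h y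
  h-harmonic y 0<y y<n with p-adic-decomposition pr y 0<y
  ... | j , u , refl , p∤u = Valuation.h-harmonic j u p∤u 0<y y<n

  h-0 : h 0 ≡ 0
  h-0 = begin
    𝟙 (¬? (n ∣? 0)) + q * ∑[ i < k ] 𝟙 (¬? (p ^ suc i ∣? 0))  ≡⟨ cong₂ (λ a b → a + q * b) (∤0 n) (∑-cong k (λ i _ → ∤0 (p ^ suc i))) ⟩
    0 + q * ∑[ i < k ] 0                                     ≡⟨ cong (q *_) (trans (∑-const k 0) (*-zeroʳ k)) ⟩
    q * 0                                                    ≡⟨ *-zeroʳ q ⟩
    0                                                        ∎
    where
    open ≡-Reasoning
    ∤0 : ∀ d → 𝟙 (¬? (d ∣? 0)) ≡ 0
    ∤0 d = 𝟙-no (¬? (d ∣? 0)) (λ d∤0 → d∤0 (d ∣0))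

  1+q*∑1≡v : 1 + q * ∑[ i < k ] 1 ≡ k * q + 1
  1+q*∑1≡v = begin
    1 + q * ∑[ i < k ] 1  ≡⟨ cong (λ b → 1 + q * b) (trans (∑-const k 1) (*-identityʳ k)) ⟩
    1 + q * k             ≡⟨ +-comm 1 (q * k) ⟩
    q * k + 1             ≡⟨ cong (_+ 1) (*-comm q k) ⟩
    k * q + 1             ∎
    where open ≡-Reasoning

  h≤ : ∀ y → h y ≤ k * q + 1
  h≤ y = ≤-trans (+-mono-≤ (𝟙≤1 (¬? (n ∣? y))) (*-monoʳ-≤ q (∑-mono-≤ k (λ i → 𝟙≤1 (¬? (p ^ suc i ∣? y))))))
                 (≤-reflexive 1+q*∑1≡v)

  h-1 : 1 < n → h 1 ≡ k * q + 1
  h-1 1<n = trans (cong₂ (λ a b → a + q * b) (∤1 1<n) (∑-cong k (λ i _ → ∤1 (^-monoʳ-< p 1<p {0} {suc i} (s≤s z≤n)))))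
                  1+q*∑1≡v
    where
    ∤1 : ∀ {d} → 1 < d → 𝟙 (¬? (d ∣? 1)) ≡ 1
    ∤1 1<d = 𝟙-yes (¬? (_ ∣? 1)) (λ d∣1 → >⇒≢ 1<d (∣1⇒≡1 d∣1))

theorem2p1 : (p k : ℕ) (pr : Prime p) → 1 ≤ k →
    ExpectedHittingTime (p ^ k) {{primePow≢0 k pr}} ((+ (k * (p ∸ 1) + 1)) / 1)
theorem2p1 p k pr 1≤k =
  subst (λ v → ExpectedHittingTime n (+ v / 1)) (trans (cong h (m<n⇒m%n≡m 1<n)) (h-1 1<n))
    (expectedHittingTime-harmonic n 1<n h (k * q + 1) h-0 h≤ h-harmonic)
  where
  open PrimePower p k pr
  1<n : 1 < n
  1<n = ≤-trans 1<p (≤-trans (≤-reflexive (sym (*-identityʳ p))) (^-monoʳ-≤ p 1≤k))
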